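{- Let $p_1\neq p_2$ be odd primes, let $\ell\geq 1$ be an integer, and suppose $2p_1$ (nontrivially) flanks $2p_2$ at distance $\ell$ at every occurrence. Set $r_1=(p_1-1)/2$. Then $r_1 \mid \bigl(2^{2\ell}-1\bigr)$.
   Context: For integers $k\ge 0$ and $n\ge 1$, $\sigma_k(n)=\sum_{d\mid n} d^k$ and $\phi(n)$ is Euler's totient function. For each $k\geq 0$, $S_k$ denotes the set of composite positive integers $n$ satisfying $n\cdot\sigma_k(n)\equiv 2 \pmod{\phi(n)}$. For $\ell\in\mathbb{N}$ and $k\ge \ell$, $n_*$ flanks $n$ at distance $\ell$ at $k$ if $n\in S_k$, $n_*\in S_{k-\ell}$ and $n_*\in S_{k+\ell}$. If $n_*$ flanks $n$ at distance $\ell$ at $k$ for every $k$ for which $n\in S_k$, and there is at least one such $k$, then $n_*$ (nontrivially) flanks $n$ at distance $\ell$ at every occurrence. -}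

module Defs where

open import Data.Nat using (ℕ; zero; suc; _+_; _*_; _^_; _∸_; _≤_)
open import Data.Nat.Divisibility using (_∣_; _∣?_)
open import Data.Nat.GCD using (gcd)
open import Data.Nat.Primality using (Composite)
open import Data.List using (List; filter; map; length)
open import Data.Nat.ListAction using (sum)
open import Data.List.Base using (upTo)
open import Data.Integer as ℤ using (ℤ; +_)
open import Data.Integer.Divisibility as ℤd using ()
open import Data.Product using (_×_; Σ)
open import Relation.Binary.PropositionalEquality using (_≡_)
open import Data.Nat using (_≟_)
open import Relation.Nullary.Decidable using (does)

range1 : ℕ → List ℕ
range1 n = map suc (upTo n)

σ : ℕ → ℕ → ℕ
σ k n = sum (map (λ d → d ^ k) (filter (λ d → d ∣? n) (range1 n)))

φ : ℕ → ℕ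
φ n = length (filter (λ m → gcd m n ≟ 1) (range1 n))

_≡_[mod_] : ℤ → ℤ → ℤ → Set
a ≡ b [mod m ] = m ℤd.∣ (a ℤ.- b)

InS : ℕ → ℕ → Set
InS k n = Composite n × ((+ (n * σ k n)) ≡ (+ 2) [mod (+ φ n) ])

-- n⋆ flanks n at distance ℓ at k  (only meaningful for k ≥ ℓ)
FlanksAt : ℕ → ℕ → ℕ → ℕ → Set
FlanksAt n⋆ n ℓ k = InS k n × InS (k ∸ ℓ) n⋆ × InS (k + ℓ) n⋆

FlanksEvery : ℕ → ℕ → ℕ → Set
FlanksEvery n⋆ n ℓ =
  ((k : ℕ) → InS k n → (ℓ ≤ k) × FlanksAt n⋆ n ℓ k) × Σ ℕ (λ k → InS k n)

module Submission where

-- Write the odd prime as p = 1 + 2r. The divisors of 2p are 1, 2, p, 2p and the residues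
-- prime to 2p are the odd numbers other than p, so σₖ(2p) = (1 + 2^k)(1 + p^k) and
-- φ(2p) = 2r. As p ≡ 1 (mod 2r), membership 2p ∈ Sₖ says 2r ∣ 2 (2^(k+1) + 1), that is
-- r ∣ 2^(k+1) + 1. At k − ℓ and k + ℓ this gives r ∣ Z + 1 and r ∣ Z · 2^(2ℓ) + 1 with
-- Z = 2^(k−ℓ+1); multiplying the first by 2^(2ℓ) and subtracting gives r ∣ 2^(2ℓ) − 1.

open import Defs
import Data.Integer as ℤ
import Data.Integer.Properties as ℤₚ
open import Data.List using (List; []; _∷_; _++_; [_]; filter; map; length; upTo)
open import Data.List.Properties using (filter-++; filter-accept; filter-reject; map-++; upTo-∷ʳ)
open import Data.Nat
open import Data.Nat.Coprimality using (Coprime; coprime⇒gcd≡1; gcd≡1⇒coprime; coprime-divisor)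
open import Data.Nat.Divisibility
open import Data.Nat.DivMod using (m*n/n≡m)
open import Data.Nat.ListAction using (sum)
open import Data.Nat.ListAction.Properties using (sum-++)
open import Data.Nat.GCD using (gcd)
open import Data.Nat.Primality
open import Data.Nat.Properties
open import Data.Nat.Tactic.RingSolver using (solve-∀)
open import Data.Product using (∃-syntax; _,_; proj₁; proj₂)
open import Data.Sum using (_⊎_; inj₁; inj₂)
open import Function using (_∘_; const)
open import Level using (0ℓ)
open import Relation.Nullary using (¬_; contradiction; yes; no)
open import Relation.Unary using (Pred; Decidable)
open import Relation.Binary.PropositionalEquality
  using (_≡_; _≢_; refl; sym; trans; cong; cong₂; subst; module ≡-Reasoning)

private variable d k m n p : ℕ

range1-suc : ∀ n → range1 (suc n) ≡ range1 n ++ [ suc n ]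
range1-suc n = trans (cong (map suc) (sym (upTo-∷ʳ n))) (map-++ suc (upTo n) [ n ])

-- σ k n unfolds to filteredSum (_∣? n) (_^ k) n.
module _ {P : Pred ℕ 0ℓ} (P? : Decidable P) (f : ℕ → ℕ) where

  filteredSum : ℕ → ℕ
  filteredSum n = sum (map f (filter P? (range1 n)))

  private
    filteredSum-suc : ∀ n → filteredSum (suc n) ≡ filteredSum n + sum (map f (filter P? [ suc n ]))
    filteredSum-suc n = begin
      sum (map f (filter P? (range1 (suc n))))
        ≡⟨ cong (sum ∘ map f ∘ filter P?) (range1-suc n) ⟩
      sum (map f (filter P? (range1 n ++ [ suc n ])))
        ≡⟨ cong (sum ∘ map f) (filter-++ P? (range1 n) [ suc n ]) ⟩
      sum (map f (filter P? (range1 n) ++ filter P? [ suc n ]))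
        ≡⟨ cong sum (map-++ f (filter P? (range1 n)) _) ⟩
      sum (map f (filter P? (range1 n)) ++ map f (filter P? [ suc n ]))
        ≡⟨ sum-++ (map f (filter P? (range1 n))) _ ⟩
      filteredSum n + sum (map f (filter P? [ suc n ])) ∎
      where open ≡-Reasoning

  filteredSum-accept : P (suc n) → filteredSum (suc n) ≡ filteredSum n + f (suc n)
  filteredSum-accept {n} Pn = begin
    filteredSum (suc n)                               ≡⟨ filteredSum-suc n ⟩
    filteredSum n + sum (map f (filter P? [ suc n ])) ≡⟨ cong (λ xs → filteredSum n + sum (map f xs)) (filter-accept P? Pn) ⟩
    filteredSum n + (f (suc n) + 0)                   ≡⟨ cong (filteredSum n +_) (+-identityʳ _) ⟩
    filteredSum n + f (suc n)                         ∎
    where open ≡-Reasoning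

  filteredSum-reject : ¬ P (suc n) → filteredSum (suc n) ≡ filteredSum n
  filteredSum-reject {n} ¬Pn = begin
    filteredSum (suc n)                               ≡⟨ filteredSum-suc n ⟩
    filteredSum n + sum (map f (filter P? [ suc n ])) ≡⟨ cong (λ xs → filteredSum n + sum (map f xs)) (filter-reject P? ¬Pn) ⟩
    filteredSum n + 0                                 ≡⟨ +-identityʳ _ ⟩
    filteredSum n                                     ∎
    where open ≡-Reasoning

  filteredSum-skip : m ≤ n → (∀ {d} → m < d → d ≤ n → ¬ P d) → filteredSum n ≡ filteredSum m
  filteredSum-skip {n = zero}  z≤n _ = refl
  filteredSum-skip {m} {suc n} m≤1+n ¬P with m≤n⇒m<n∨m≡n m≤1+n
  ... | inj₂ refl        = refl
  ... | inj₁ (s≤s m≤n) = trans (filteredSum-reject (¬P (s≤s m≤n) ≤-refl))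
                               (filteredSum-skip m≤n (λ m<d d≤n → ¬P m<d (m≤n⇒m≤1+n d≤n)))

2∣n⇒2∤1+n : 2 ∣ n → 2 ∤ suc n
2∣n⇒2∤1+n {n} 2∣n 2∣1+n with ∣1⇒≡1 (∣m+n∣m⇒∣n (subst (2 ∣_) (+-comm 1 n) 2∣1+n) 2∣n)
... | ()

module _ {P : Pred ℕ 0ℓ} (P? : Decidable P) where

  filteredCount : ℕ → ℕ
  filteredCount = filteredSum P? (const 1)

  length-filter≡filteredCount : ∀ n → length (filter P? (range1 n)) ≡ filteredCount n
  length-filter≡filteredCount n = length≡sum-map-const-1 (filter P? (range1 n))
    where
      length≡sum-map-const-1 : (xs : List ℕ) → length xs ≡ sum (map (const 1) xs)
      length≡sum-map-const-1 []       = refl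
      length≡sum-map-const-1 (_ ∷ xs) = cong suc (length≡sum-map-const-1 xs)

  filteredCount-odd : ∀ {m} j → 2 ∣ m →
    (∀ {d} → m < d → d ≤ m + 2 * j → 2 ∤ d → P d) → (∀ {d} → 2 ∣ d → ¬ P d) →
    filteredCount (m + 2 * j) ≡ filteredCount m + j
  filteredCount-odd {m} zero _ _ _ = trans (cong filteredCount (+-identityʳ m)) (sym (+-identityʳ _))
  filteredCount-odd {m} (suc j) 2∣m odd⇒P even⇒¬P = begin
    filteredCount (m + 2 * suc j)   ≡⟨ cong filteredCount (shift m j) ⟩
    filteredCount (2 + (m + 2 * j)) ≡⟨ filteredSum-reject P? _ (even⇒¬P (∣m∣n⇒∣m+n (∣-refl {2}) 2∣m+2j)) ⟩
    filteredCount (1 + (m + 2 * j)) ≡⟨ filteredSum-accept P? _ (odd⇒P (s≤s (m≤m+n m _)) top≤ (2∣n⇒2∤1+n 2∣m+2j)) ⟩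
    filteredCount (m + 2 * j) + 1   ≡⟨ cong (_+ 1) (filteredCount-odd j 2∣m (λ m<d d≤ → odd⇒P m<d (≤-trans d≤ lower≤)) even⇒¬P) ⟩
    filteredCount m + j + 1         ≡⟨ trans (+-assoc (filteredCount m) j 1) (cong (filteredCount m +_) (+-comm j 1)) ⟩
    filteredCount m + suc j         ∎
    where
      open ≡-Reasoning
      shift : ∀ m j → m + 2 * suc j ≡ 2 + (m + 2 * j)
      shift = solve-∀
      2∣m+2j : 2 ∣ m + 2 * j
      2∣m+2j = ∣m∣n⇒∣m+n 2∣m (m∣m*n j)
      top≤ : 1 + (m + 2 * j) ≤ m + 2 * suc j
      top≤ = ≤-trans (n≤1+n _) (≤-reflexive (sym (shift m j)))
      lower≤ : m + 2 * j ≤ m + 2 * suc j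
      lower≤ = ≤-trans (n≤1+n _) top≤

even⊎odd : ∀ n → (∃[ r ] n ≡ 2 * r) ⊎ (∃[ r ] n ≡ 1 + 2 * r)
even⊎odd zero = inj₁ (0 , refl)
even⊎odd (suc n) with even⊎odd n
... | inj₁ (r , refl) = inj₂ (r , refl)
... | inj₂ (r , refl) = inj₁ (suc r , cong suc (sym (+-suc r (r + 0))))

prime≢2⇒odd : Prime p → p ≢ 2 → ∃[ r ] p ≡ 1 + 2 * r
prime≢2⇒odd {p} p-prime p≢2 with even⊎odd p
... | inj₂ odd = odd
... | inj₁ (r , refl) with prime⇒irreducible p-prime (m∣m*n r)
...   | inj₁ ()
...   | inj₂ 2≡p = contradiction (sym 2≡p) p≢2

prime≢2⇒2<p : Prime p → p ≢ 2 → 2 < p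
prime≢2⇒2<p p-prime p≢2 = ≤∧≢⇒< (nonTrivial⇒n>1 _ {{prime⇒nonTrivial p-prime}}) (p≢2 ∘ sym)

prime∧∤⇒coprime : Prime p → p ∤ d → Coprime d p
prime∧∤⇒coprime p-prime p∤d (c∣d , c∣p) with prime⇒irreducible p-prime c∣p
... | inj₁ c≡1  = c≡1
... | inj₂ refl = contradiction c∣d p∤d

∣2*p⇒≡1⊎2⊎p⊎2*p : Prime p → d ∣ 2 * p → d ≡ 1 ⊎ d ≡ 2 ⊎ d ≡ p ⊎ d ≡ 2 * p
∣2*p⇒≡1⊎2⊎p⊎2*p {p} {d} p-prime d∣2p with p ∣? d
... | yes (divides a refl) with irreducible[2] {a} (*-cancelʳ-∣ p {{prime⇒nonZero p-prime}} d∣2p)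
...   | inj₁ refl = inj₂ (inj₂ (inj₁ (+-identityʳ p)))
...   | inj₂ refl = inj₂ (inj₂ (inj₂ refl))
∣2*p⇒≡1⊎2⊎p⊎2*p {p} {d} p-prime d∣2p | no p∤d
  with irreducible[2] {d} (coprime-divisor (prime∧∤⇒coprime p-prime p∤d) (subst (d ∣_) (*-comm 2 p) d∣2p))
...   | inj₁ d≡1 = inj₁ d≡1
...   | inj₂ d≡2 = inj₂ (inj₁ d≡2)

odd⇒coprime[2*p] : Prime p → 2 ∤ d → d ≤ 2 * p → d ≢ p → Coprime d (2 * p)
odd⇒coprime[2*p] {p} {d} p-prime 2∤d d≤2p d≢p (c∣d , c∣2p) with ∣2*p⇒≡1⊎2⊎p⊎2*p p-prime c∣2p
... | inj₁ c≡1                 = c≡1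
... | inj₂ (inj₁ refl)         = contradiction c∣d 2∤d
... | inj₂ (inj₂ (inj₂ refl))  = contradiction (∣-trans (m∣m*n p) c∣d) 2∤d
... | inj₂ (inj₂ (inj₁ refl)) with c∣d
...   | divides 0 refl             = contradiction (2 ∣0) 2∤d
...   | divides 1 refl             = contradiction (+-identityʳ p) d≢p
...   | divides 2 refl             = contradiction (m∣m*n p) 2∤d
...   | divides (suc (suc (suc a))) refl =
          contradiction (*-cancelʳ-≤ (3 + a) 2 p {{prime⇒nonZero p-prime}} d≤2p) (<⇒≱ (s≤s (s≤s (s≤s z≤n))))

φ[2*p]≡p∸1 : Prime p → p ≢ 2 → φ (2 * p) ≡ p ∸ 1
φ[2*p]≡p∸1 {p} p-prime p≢2 with prime≢2⇒odd p-prime p≢2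
... | r , refl = begin
  φ (2 * p)                      ≡⟨ length-filter≡filteredCount P? (2 * p) ⟩
  count (2 * p)                  ≡⟨ cong count (2*[1+2r]≡[2+2r]+2r r) ⟩
  count ((2 + 2 * r) + 2 * r)    ≡⟨ filteredCount-odd P? r (∣m∣n⇒∣m+n (∣-refl {2}) (m∣m*n r)) upper-odd⇒P even⇒¬P ⟩
  count (2 + 2 * r) + r          ≡⟨ cong (_+ r) (filteredSum-reject P? _ (even⇒¬P (∣m∣n⇒∣m+n (∣-refl {2}) (m∣m*n r)))) ⟩
  count p + r                    ≡⟨ cong (_+ r) (filteredSum-reject P? _ ¬P[p]) ⟩
  count (2 * r) + r              ≡⟨ cong (_+ r) (filteredCount-odd P? r (2 ∣0) lower-odd⇒P even⇒¬P) ⟩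
  r + r                          ≡⟨ cong (r +_) (sym (+-identityʳ r)) ⟩
  2 * r                          ∎
  where
    open ≡-Reasoning
    P? = λ m → gcd m (2 * p) ≟ 1
    count = filteredCount P?

    2*[1+2r]≡[2+2r]+2r : ∀ r → 2 * (1 + 2 * r) ≡ (2 + 2 * r) + 2 * r
    2*[1+2r]≡[2+2r]+2r = solve-∀

    even⇒¬P : ∀ {d} → 2 ∣ d → gcd d (2 * p) ≢ 1
    even⇒¬P 2∣d gcd≡1 with () ← gcd≡1⇒coprime gcd≡1 (2∣d , m∣m*n p)

    ¬P[p] : gcd p (2 * p) ≢ 1
    ¬P[p] gcd≡1 = ¬prime[1] (subst Prime (gcd≡1⇒coprime gcd≡1 (∣-refl , n∣m*n 2)) p-prime)

    lower-odd⇒P : ∀ {d} → 0 < d → d ≤ 2 * r → 2 ∤ d → gcd d (2 * p) ≡ 1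
    lower-odd⇒P _ d≤2r 2∤d = coprime⇒gcd≡1 (odd⇒coprime[2*p] p-prime 2∤d
      (≤-trans (m≤n⇒m≤1+n d≤2r) (m≤m+n p _)) (<⇒≢ (s≤s d≤2r)))

    upper-odd⇒P : ∀ {d} → 2 + 2 * r < d → d ≤ (2 + 2 * r) + 2 * r → 2 ∤ d → gcd d (2 * p) ≡ 1
    upper-odd⇒P {d} 2+2r<d d≤ 2∤d = coprime⇒gcd≡1 (odd⇒coprime[2*p] p-prime 2∤d
      (subst (d ≤_) (sym (2*[1+2r]≡[2+2r]+2r r)) d≤) (>⇒≢ (<-trans (n<1+n p) 2+2r<d)))

∣2*p⇒≡p : Prime p → d ∣ 2 * p → 2 < d → d < 2 * p → d ≡ p
∣2*p⇒≡p p-prime d∣2p 2<d d<2p with ∣2*p⇒≡1⊎2⊎p⊎2*p p-prime d∣2p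
... | inj₁ refl                = contradiction 2<d (<⇒≱ (s≤s (s≤s z≤n)))
... | inj₂ (inj₁ refl)         = contradiction 2<d (<-irrefl refl)
... | inj₂ (inj₂ (inj₁ d≡p))   = d≡p
... | inj₂ (inj₂ (inj₂ refl))  = contradiction d<2p (<-irrefl refl)

^-distribʳ-* : ∀ m n k → (m * n) ^ k ≡ m ^ k * n ^ k
^-distribʳ-* m n zero    = refl
^-distribʳ-* m n (suc k) = trans (cong (m * n *_) (^-distribʳ-* m n k)) (interchange m n (m ^ k) (n ^ k))
  where
    interchange : ∀ a b c d → a * b * (c * d) ≡ a * c * (b * d)
    interchange = solve-∀

σ[2*p] : ∀ k → Prime p → 2 < p → σ k (2 * p) ≡ (1 + 2 ^ k) * (1 + p ^ k)
σ[2*p] {p@(suc q)} k p-prime 2<p@(s≤s 2≤q) = begin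
  σ k (2 * p)                              ≡⟨ filteredSum-accept D? f ∣-refl ⟩
  S (pred (2 * p)) + (2 * p) ^ k           ≡⟨ cong (_+ (2 * p) ^ k) (filteredSum-skip D? f p≤pred[2p] no-divisor-above-p) ⟩
  S p + (2 * p) ^ k                        ≡⟨ cong (_+ (2 * p) ^ k) (filteredSum-accept D? f (n∣m*n 2)) ⟩
  S q + p ^ k + (2 * p) ^ k                ≡⟨ cong (λ s → s + p ^ k + (2 * p) ^ k) (filteredSum-skip D? f 2≤q no-divisor-below-p) ⟩
  S 2 + p ^ k + (2 * p) ^ k                ≡⟨ cong (λ s → s + p ^ k + (2 * p) ^ k) (filteredSum-accept D? f (m∣m*n p)) ⟩
  S 1 + 2 ^ k + p ^ k + (2 * p) ^ k        ≡⟨ cong (λ s → s + 2 ^ k + p ^ k + (2 * p) ^ k) (filteredSum-accept D? f (1∣ _)) ⟩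
  0 + 1 ^ k + 2 ^ k + p ^ k + (2 * p) ^ k  ≡⟨ cong₂ (λ a b → 0 + a + 2 ^ k + p ^ k + b) (^-zeroˡ k) (^-distribʳ-* 2 p k) ⟩
  0 + 1 + 2 ^ k + p ^ k + 2 ^ k * p ^ k    ≡⟨ factorise (2 ^ k) (p ^ k) ⟩
  (1 + 2 ^ k) * (1 + p ^ k)                ∎
  where
    open ≡-Reasoning
    D? = _∣? 2 * p
    f = _^ k
    S = filteredSum D? f

    p≤pred[2p] : p ≤ pred (2 * p)
    p≤pred[2p] = ≤-trans (m≤m+n p 0) (m≤n+m (p + 0) q)

    no-divisor-above-p : ∀ {d} → p < d → d ≤ pred (2 * p) → d ∤ 2 * p
    no-divisor-above-p p<d d≤ d∣2p =
      >⇒≢ p<d (∣2*p⇒≡p p-prime d∣2p (<-trans 2<p p<d) (s≤s d≤))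

    no-divisor-below-p : ∀ {d} → 2 < d → d ≤ q → d ∤ 2 * p
    no-divisor-below-p 2<d d≤q d∣2p =
      <⇒≢ (s≤s d≤q) (∣2*p⇒≡p p-prime d∣2p 2<d (<-≤-trans (s≤s d≤q) (m≤m+n p _)))

    factorise : ∀ a b → 0 + 1 + a + b + a * b ≡ (1 + a) * (1 + b)
    factorise = solve-∀

[1+m]^n≡1+m*q : ∀ m n → ∃[ q ] (1 + m) ^ n ≡ 1 + m * q
[1+m]^n≡1+m*q m zero    = 0 , cong suc (sym (*-zeroʳ m))
[1+m]^n≡1+m*q m (suc n) with [1+m]^n≡1+m*q m n
... | q , eq = 1 + q + m * q , trans (cong ((1 + m) *_) eq) (expand m q)
  where
    expand : ∀ m q → (1 + m) * (1 + m * q) ≡ 1 + m * (1 + q + m * q)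
    expand = solve-∀

+[n+m]≡+n[mod+d]⇒d∣m : (ℤ.+ (n + m)) ≡ (ℤ.+ n) [mod (ℤ.+ d) ] → d ∣ m
+[n+m]≡+n[mod+d]⇒d∣m {n} {m} {d} d∣ = subst (d ∣_) (cong ℤ.∣_∣ difference) d∣
  where
    difference : ℤ.+ (n + m) ℤ.- ℤ.+ n ≡ ℤ.+ m
    difference = trans (ℤₚ.[+m]-[+n]≡m⊖n (n + m) n)
                       (trans (ℤₚ.≤-⊖ (m≤m+n n m)) (cong ℤ.+_ (m+n∸m≡n n m)))

2p∈Sₖ⇒[p∸1]/2∣2^[1+k]+1 : Prime p → p ≢ 2 → InS k (2 * p) → (p ∸ 1) / 2 ∣ 2 ^ suc k + 1
2p∈Sₖ⇒[p∸1]/2∣2^[1+k]+1 {p} {k} p-prime p≢2 (_ , 2pσ≡2) with prime≢2⇒odd p-prime p≢2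
... | r , refl = subst (_∣ 2 ^ suc k + 1) (sym 2r/2≡r) (*-cancelˡ-∣ 2 2r∣2[2^[1+k]+1])
  where
    open ≡-Reasoning
    X = 2 ^ k
    A = proj₁ ([1+m]^n≡1+m*q (2 * r) k)
    Q = 2 * (1 + X) * (2 + A + 2 * r * A)

    -- p ≡ 1 (mod 2r), so 2p (1 + 2^k) (1 + p^k) ≡ 4 (1 + 2^k) = 2 + 2 (2^(k+1) + 1).
    reduce : ∀ r X A → 2 * (1 + 2 * r) * ((1 + X) * (1 + (1 + 2 * r * A)))
                       ≡ 2 + (2 * r * (2 * (1 + X) * (2 + A + 2 * r * A)) + 2 * (2 * X + 1))
    reduce = solve-∀

    2pσ≡2+[2rQ+2[2^[1+k]+1]] : 2 * p * σ k (2 * p) ≡ 2 + (2 * r * Q + 2 * (2 ^ suc k + 1))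
    2pσ≡2+[2rQ+2[2^[1+k]+1]] = begin
      2 * p * σ k (2 * p)                        ≡⟨ cong (2 * p *_) (σ[2*p] k p-prime (prime≢2⇒2<p p-prime p≢2)) ⟩
      2 * p * ((1 + X) * (1 + p ^ k))            ≡⟨ cong (λ t → 2 * p * ((1 + X) * (1 + t))) (proj₂ ([1+m]^n≡1+m*q (2 * r) k)) ⟩
      2 * p * ((1 + X) * (1 + (1 + 2 * r * A)))  ≡⟨ reduce r X A ⟩
      2 + (2 * r * Q + 2 * (2 ^ suc k + 1))      ∎

    2r∣2[2^[1+k]+1] : 2 * r ∣ 2 * (2 ^ suc k + 1)
    2r∣2[2^[1+k]+1] = ∣m+n∣m⇒∣n (subst (_∣ 2 * r * Q + 2 * (2 ^ suc k + 1)) (φ[2*p]≡p∸1 p-prime p≢2)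
      (+[n+m]≡+n[mod+d]⇒d∣m {n = 2} (subst (λ t → (ℤ.+ t) ≡ (ℤ.+ 2) [mod (ℤ.+ φ (2 * p)) ]) 2pσ≡2+[2rQ+2[2^[1+k]+1]] 2pσ≡2)))
      (m∣m*n Q)

    2r/2≡r : 2 * r / 2 ≡ r
    2r/2≡r = trans (cong (_/ 2) (*-comm 2 r)) (m*n/n≡m r 2)

∣m+1∧∣m*n+1⇒∣n∸1 : d ∣ m + 1 → d ∣ m * n + 1 → d ∣ n ∸ 1
∣m+1∧∣m*n+1⇒∣n∸1 {d} {n = zero}  _ _ = d ∣0
∣m+1∧∣m*n+1⇒∣n∸1 {d} {m} {suc n} d∣m+1 d∣mn+1 =
  ∣m+n∣m⇒∣n (subst (d ∣_) (expand m n) (∣m⇒∣m*n (suc n) d∣m+1)) d∣mn+1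
  where
    expand : ∀ m n → (m + 1) * suc n ≡ m * suc n + 1 + n
    expand = solve-∀

m^[1+n+o]≡m^[1+n∸o]*m^[2o] : ∀ m {n o} → o ≤ n → m ^ suc (n + o) ≡ m ^ suc (n ∸ o) * m ^ (2 * o)
m^[1+n+o]≡m^[1+n∸o]*m^[2o] m {n} {o} o≤n = begin
  m ^ suc (n + o)                   ≡⟨ cong (λ e → m ^ suc (e + o)) (sym (m∸n+n≡m o≤n)) ⟩
  m ^ suc (n ∸ o + o + o)           ≡⟨ cong (λ e → m ^ suc e) (regroup (n ∸ o) o) ⟩
  m ^ (suc (n ∸ o) + 2 * o)         ≡⟨ ^-distribˡ-+-* m (suc (n ∸ o)) (2 * o) ⟩
  m ^ suc (n ∸ o) * m ^ (2 * o)     ∎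
  where
    open ≡-Reasoning
    regroup : ∀ a o → a + o + o ≡ a + 2 * o
    regroup = solve-∀

-- Only one occurrence k is needed.
lemma3p1 : (p₁ p₂ ℓ : ℕ) → Prime p₁ → Prime p₂ → p₁ ≢ 2 → p₂ ≢ 2 → p₁ ≢ p₂ →
    ℓ ≥ 1 → FlanksEvery (2 * p₁) (2 * p₂) ℓ →
    ((p₁ ∸ 1) / 2) ∣ (2 ^ (2 * ℓ) ∸ 1)
lemma3p1 p₁ _ ℓ p₁-prime _ p₁≢2 _ _ _ (flanks , k , 2p₂∈Sₖ) with flanks k 2p₂∈Sₖ
... | ℓ≤k , _ , 2p₁∈Sₖ₋ℓ , 2p₁∈Sₖ₊ℓ =
  ∣m+1∧∣m*n+1⇒∣n∸1 (2p∈Sₖ⇒[p∸1]/2∣2^[1+k]+1 {k = k ∸ ℓ} p₁-prime p₁≢2 2p₁∈Sₖ₋ℓ)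
    (subst (λ t → (p₁ ∸ 1) / 2 ∣ t + 1) (m^[1+n+o]≡m^[1+n∸o]*m^[2o] 2 ℓ≤k)
      (2p∈Sₖ⇒[p∸1]/2∣2^[1+k]+1 {k = k + ℓ} p₁-prime p₁≢2 2p₁∈Sₖ₊ℓ))
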